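{- Let $w$ be a 2D word of size $(m,n)$ with $m,n\ge 2$, and let $BOR(w)$ be the set of all borders of $w$. (1) If $w$ is a 2D palindrome, then $2\le|BOR(w)|\le mn$. (2) If $w$ is an HV-palindrome, then $4\le|BOR(w)|\le mn$.
   Context: A 2D word of size $(m,n)$ over a finite alphabet is an $m\times n$ array $w=[w_{i,j}]$; its rows and columns are 1D words. A 1D word is a palindrome if it equals its reversal. The reverse of $w$ is $w^R=[w_{m-i+1,\,n-j+1}]_{i,j}$; $w$ is a 2D palindrome if $w=w^R$, and an HV-palindrome if each of its rows and columns is a 1D palindrome. A prefix of $w$ is a top-left sub-array $[w_{i,j}]_{1\le i\le a,\,1\le j\le b}$, and a suffix is a bottom-right sub-array $[w_{i,j}]_{m-a+1\le i\le m,\,n-b+1\le j\le n}$ ($1\le a\le m$, $1\le b\le n$). A border of $w$ is a non-empty 2D word that is both a prefix and a suffix of $w$; $BOR(w)$ is the set of distinct such 2D words. -}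

module Defs where

open import Data.Nat using (ℕ; suc; _≤_; _∸_)
open import Data.Nat.Properties using (m∸n+n≡m)
open import Data.Fin using (Fin; toℕ; inject≤; _↑ʳ_; cast; opposite)
open import Data.Fin.Properties using (all?; toℕ<n) renaming (_≟_ to _≟ᶠ_)
open import Data.List using (List; filter; cartesianProduct; allFin; length)
open import Data.Product using (_×_; _,_)
open import Relation.Binary.PropositionalEquality using (_≡_)
open import Relation.Nullary using (Dec)

Word2D : ℕ → ℕ → ℕ → Set
Word2D k m n = Fin m → Fin n → Fin k

Word1D : ℕ → ℕ → Set
Word1D k n = Fin n → Fin k

reverse1D : ∀ {k n} → Word1D k n → Word1D k n
reverse1D u j = u (opposite j)

IsPalindrome : ∀ {k n} → Word1D k n → Set
IsPalindrome u = ∀ j → u j ≡ reverse1D u j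

reverse2D : ∀ {k m n} → Word2D k m n → Word2D k m n
reverse2D w i j = w (opposite i) (opposite j)

Is2DPalindrome : ∀ {k m n} → Word2D k m n → Set
Is2DPalindrome w = ∀ i j → w i j ≡ reverse2D w i j

row : ∀ {k m n} → Word2D k m n → Fin m → Word1D k n
row w i j = w i j

col : ∀ {k m n} → Word2D k m n → Fin n → Word1D k m
col w j i = w i j

IsHVPalindrome : ∀ {k m n} → Word2D k m n → Set
IsHVPalindrome {m = m} {n = n} w =
  ((i : Fin m) → IsPalindrome (row w i)) × ((j : Fin n) → IsPalindrome (col w j))

preIdx : ∀ {a m} → a ≤ m → Fin a → Fin m
preIdx p i = inject≤ i p

sufIdx : ∀ {a m} → a ≤ m → Fin a → Fin m
sufIdx {a} {m} p i = cast (m∸n+n≡m p) ((m ∸ a) ↑ʳ i)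

prefix : ∀ {k m n a b} → a ≤ m → b ≤ n → Word2D k m n → Word2D k a b
prefix p q w i j = w (preIdx p i) (preIdx q j)

suffix : ∀ {k m n a b} → a ≤ m → b ≤ n → Word2D k m n → Word2D k a b
suffix p q w i j = w (sufIdx p i) (sufIdx q j)

PrefixIsSuffix : ∀ {k m n a b} → a ≤ m → b ≤ n → Word2D k m n → Set
PrefixIsSuffix p q w = ∀ i j → prefix p q w i j ≡ suffix p q w i j

prefixIsSuffix? : ∀ {k m n a b} (p : a ≤ m) (q : b ≤ n) (w : Word2D k m n) →
                  Dec (PrefixIsSuffix p q w)
prefixIsSuffix? p q w = all? (λ i → all? (λ j → prefix p q w i j ≟ᶠ suffix p q w i j))

-- A border of size (a,b) with 1 ≤ a ≤ m, 1 ≤ b ≤ n is encoded by a pair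
-- (a', b') : Fin m × Fin n with a = a'+1, b = b'+1.
-- (w has a border of size (a,b) iff its (a,b)-prefix equals its (a,b)-suffix.)
IsBorderSize : ∀ {k m n} → Word2D k m n → Fin m × Fin n → Set
IsBorderSize w (a , b) = PrefixIsSuffix (toℕ<n a) (toℕ<n b) w

isBorderSize? : ∀ {k m n} (w : Word2D k m n) (s : Fin m × Fin n) → Dec (IsBorderSize w s)
isBorderSize? w (a , b) = prefixIsSuffix? (toℕ<n a) (toℕ<n b) w

-- BOR(w), each border represented by its (unique) size; distinct borders
-- are exactly distinct sizes, since a border is determined by its size.
BOR : ∀ {k m n} → Word2D k m n → List (Fin m × Fin n)
BOR {m = m} {n = n} w = filter (isBorderSize? w) (cartesianProduct (allFin m) (allFin n))

#BOR : ∀ {k m n} → Word2D k m n → ℕ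
#BOR w = length (BOR w)

-- The whole word is always a border, and for a 2D palindrome so is the 1×1
-- corner, since w₁₁ = wₘₙ.  An HV-palindrome is a 2D palindrome whose first
-- row equals its last row and whose first column equals its last column,
-- giving the 1×n and m×1 borders too; for m, n ≥ 2 these four sizes are
-- distinct.  The upper bound holds because BOR(w) is a sublist of the m·n
-- possible sizes.
module Submission where

open import Defs
open import Data.Nat using (ℕ; _≤_; _*_; _+_; _∸_; suc; s≤s; z≤n)
open import Data.Nat.Properties using (+-identityʳ; n∸n≡0; ≤-trans; ≤-reflexive)
open import Data.Fin using (Fin; toℕ; fromℕ; zero; suc; opposite; _↑ʳ_)
open import Data.Fin.Properties
  using (toℕ-injective; toℕ-inject≤; toℕ-cast; toℕ-↑ʳ; toℕ-fromℕ; toℕ<n; injective⇒≤)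
open import Data.List using (List; []; _∷_; _++_; length; cartesianProduct; allFin; map; lookup)
open import Data.List.Properties using (length-filter; length-++; length-map; length-tabulate)
open import Data.List.Membership.Propositional using (_∈_)
open import Data.List.Membership.Propositional.Properties
  using (∈-cartesianProduct⁺; ∈-allFin; ∈-filter⁺)
open import Data.List.Relation.Unary.Any using (index)
open import Data.List.Relation.Unary.Any.Properties using (lookup-index)
open import Data.Product using (_×_; _,_)
open import Function.Definitions using (Injective)
open import Relation.Binary.PropositionalEquality using (_≡_; refl; sym; trans; cong; cong₂)
open import Relation.Binary.PropositionalEquality.Properties using (module ≡-Reasoning)
open ≡-Reasoning

private
  variable
    A B : Set
    k m n a : ℕ

injective-into-list⇒≤length : {xs : List A} (f : Fin k → A) → Injective _≡_ _≡_ f →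
                              (∀ i → f i ∈ xs) → k ≤ length xs
injective-into-list⇒≤length {xs = xs} f f-injective f∈xs = injective⇒≤ position-injective
  where
  f≡lookup : ∀ i → f i ≡ lookup xs (index (f∈xs i))
  f≡lookup i = lookup-index (f∈xs i)

  position-injective : Injective _≡_ _≡_ (λ i → index (f∈xs i))
  position-injective {i} {j} eq = f-injective (begin
    f i                          ≡⟨ f≡lookup i ⟩
    lookup xs (index (f∈xs i))   ≡⟨ cong (lookup xs) eq ⟩
    lookup xs (index (f∈xs j))   ≡⟨ sym (f≡lookup j) ⟩
    f j                          ∎)

length-cartesianProduct : (xs : List A) (ys : List B) →
                          length (cartesianProduct xs ys) ≡ length xs * length ys
length-cartesianProduct []       ys = refl
length-cartesianProduct (x ∷ xs) ys = begin
  length (map (x ,_) ys ++ cartesianProduct xs ys)         ≡⟨ length-++ (map (x ,_) ys) ⟩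
  length (map (x ,_) ys) + length (cartesianProduct xs ys) ≡⟨ cong₂ _+_ (length-map (x ,_) ys)
                                                                         (length-cartesianProduct xs ys) ⟩
  length ys + length xs * length ys                        ∎

length-allFin : ∀ n → length (allFin n) ≡ n
length-allFin n = length-tabulate {n = n} (λ i → i)

#BOR≤m*n : (w : Word2D k m n) → #BOR w ≤ m * n
#BOR≤m*n {m = m} {n = n} w = ≤-trans
  (length-filter (isBorderSize? w) (cartesianProduct (allFin m) (allFin n)))
  (≤-reflexive (trans (length-cartesianProduct (allFin m) (allFin n))
                      (cong₂ _*_ (length-allFin m) (length-allFin n))))

toℕ-sufIdx : (p : a ≤ m) (i : Fin a) → toℕ (sufIdx p i) ≡ (m ∸ a) + toℕ i
toℕ-sufIdx {a} {m} p i = trans (toℕ-cast _ ((m ∸ a) ↑ʳ i)) (toℕ-↑ʳ (m ∸ a) i)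

sufIdx≡preIdx : (p : a ≤ m) → a ≡ m → (i : Fin a) → sufIdx p i ≡ preIdx p i
sufIdx≡preIdx {a} p refl i = toℕ-injective (begin
  toℕ (sufIdx p i)   ≡⟨ toℕ-sufIdx p i ⟩
  (a ∸ a) + toℕ i    ≡⟨ cong (_+ toℕ i) (n∸n≡0 a) ⟩
  toℕ i              ≡⟨ toℕ-inject≤ i p ⟨
  toℕ (preIdx p i)   ∎)

sufIdx-zero : (p : 1 ≤ suc m) → sufIdx p zero ≡ fromℕ m
sufIdx-zero {m} p = toℕ-injective (begin
  toℕ (sufIdx p zero) ≡⟨ toℕ-sufIdx p zero ⟩
  m + 0               ≡⟨ +-identityʳ m ⟩
  m                   ≡⟨ toℕ-fromℕ m ⟨
  toℕ (fromℕ m)       ∎)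

-- The size encoded by fromℕ m is suc (toℕ (fromℕ m)), equal to suc m only propositionally.
sufIdx-whole : ∀ m (i : Fin (suc (toℕ (fromℕ m)))) →
               sufIdx (toℕ<n (fromℕ m)) i ≡ preIdx (toℕ<n (fromℕ m)) i
sufIdx-whole m = sufIdx≡preIdx (toℕ<n (fromℕ m)) (cong suc (toℕ-fromℕ m))

module _ {k m n : ℕ} (w : Word2D k (suc m) (suc n)) where

  isBorderSize-whole : IsBorderSize w (fromℕ m , fromℕ n)
  isBorderSize-whole i j = sym (cong₂ w (sufIdx-whole m i) (sufIdx-whole n j))

  isBorderSize-1×1 : w zero zero ≡ w (fromℕ m) (fromℕ n) → IsBorderSize w (zero , zero)
  isBorderSize-1×1 corners zero zero = trans corners
    (sym (cong₂ w (sufIdx-zero (toℕ<n {suc m} zero)) (sufIdx-zero (toℕ<n {suc n} zero))))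

  isBorderSize-1×n : (∀ j → w zero j ≡ w (fromℕ m) j) → IsBorderSize w (zero , fromℕ n)
  isBorderSize-1×n rows zero j = trans (rows _)
    (sym (cong₂ w (sufIdx-zero (toℕ<n {suc m} zero)) (sufIdx-whole n j)))

  isBorderSize-m×1 : (∀ i → w i zero ≡ w i (fromℕ n)) → IsBorderSize w (fromℕ m , zero)
  isBorderSize-m×1 cols i zero = trans (cols _)
    (sym (cong₂ w (sufIdx-whole m i) (sufIdx-zero (toℕ<n {suc n} zero))))

HV⇒2D : {w : Word2D k m n} → IsHVPalindrome w → Is2DPalindrome w
HV⇒2D (rows , cols) i j = trans (cols j i) (rows (opposite i) j)

distinct-borders⇒≤#BOR : (w : Word2D k m n) (f : Fin a → Fin m × Fin n) → Injective _≡_ _≡_ f →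
                         (∀ i → IsBorderSize w (f i)) → a ≤ #BOR w
distinct-borders⇒≤#BOR w f f-injective borders = injective-into-list⇒≤length f f-injective
  (λ i → ∈-filter⁺ (isBorderSize? w) (∈-cartesianProduct⁺ (∈-allFin _) (∈-allFin _)) (borders i))

module _ {m n : ℕ} where

  diagonal : Fin 2 → Fin (suc (suc m)) × Fin (suc (suc n))
  diagonal zero       = zero , zero
  diagonal (suc zero) = fromℕ (suc m) , fromℕ (suc n)

  diagonal-injective : Injective _≡_ _≡_ diagonal
  diagonal-injective {zero}     {zero}     _  = refl
  diagonal-injective {suc zero} {suc zero} _  = refl
  diagonal-injective {zero}     {suc zero} ()

  corner : Fin 4 → Fin (suc (suc m)) × Fin (suc (suc n))
  corner zero                   = zero , zero
  corner (suc zero)             = zero , fromℕ (suc n)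
  corner (suc (suc zero))       = fromℕ (suc m) , zero
  corner (suc (suc (suc zero))) = fromℕ (suc m) , fromℕ (suc n)

  corner-injective : Injective _≡_ _≡_ corner
  corner-injective {zero}                   {zero}                   _ = refl
  corner-injective {suc zero}               {suc zero}               _ = refl
  corner-injective {suc (suc zero)}         {suc (suc zero)}         _ = refl
  corner-injective {suc (suc (suc zero))}   {suc (suc (suc zero))}   _ = refl
  corner-injective {zero}                   {suc zero}               ()
  corner-injective {zero}                   {suc (suc zero)}         ()
  corner-injective {zero}                   {suc (suc (suc zero))}   ()
  corner-injective {suc zero}               {suc (suc zero)}         ()
  corner-injective {suc zero}               {suc (suc (suc zero))}   ()
  corner-injective {suc (suc zero)}         {suc (suc (suc zero))}   ()

module _ {k m n : ℕ} (w : Word2D k (suc (suc m)) (suc (suc n))) where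

  2D-palindrome⇒2≤#BOR : Is2DPalindrome w → 2 ≤ #BOR w
  2D-palindrome⇒2≤#BOR palindrome = distinct-borders⇒≤#BOR w diagonal diagonal-injective λ where
    zero       → isBorderSize-1×1 w (palindrome zero zero)
    (suc zero) → isBorderSize-whole w

  HV-palindrome⇒4≤#BOR : IsHVPalindrome w → 4 ≤ #BOR w
  HV-palindrome⇒4≤#BOR hv@(rows , cols) = distinct-borders⇒≤#BOR w corner corner-injective λ where
    zero                   → isBorderSize-1×1 w (HV⇒2D hv zero zero)
    (suc zero)             → isBorderSize-1×n w (λ j → cols j zero)
    (suc (suc zero))       → isBorderSize-m×1 w (λ i → rows i zero)
    (suc (suc (suc zero))) → isBorderSize-whole w

lemma3p8 : (k m n : ℕ) → 2 ≤ m → 2 ≤ n → (w : Word2D k m n) →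
    (Is2DPalindrome w → 2 ≤ #BOR w × #BOR w ≤ m * n) ×
    (IsHVPalindrome w → 4 ≤ #BOR w × #BOR w ≤ m * n)
lemma3p8 k (suc (suc m)) (suc (suc n)) (s≤s (s≤s z≤n)) (s≤s (s≤s z≤n)) w =
  (λ palindrome → 2D-palindrome⇒2≤#BOR w palindrome , #BOR≤m*n w) ,
  (λ hv → HV-palindrome⇒4≤#BOR w hv , #BOR≤m*n w)
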